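{- Let $\Sigma$ be a nonempty set and let $q_{in},q_{out},f_{in},f_{out}:\Sigma^2\to\Sigma$ be binary quasigroups. Define $q,f:\Sigma^3\to\Sigma$ by $q(x_1,x_2,x_3)=q_{out}(x_1,q_{in}(x_2,x_3))$ and $f(x_1,x_2,x_3)=f_{out}(x_1,f_{in}(x_2,x_3))$, and let $(o_1,o_2,o_3)\in\Sigma^3$. Assume that for all $(x_1,x_2,x_3)\in\Sigma^3$ we have $q(o_1,x_2,x_3)=f(o_1,x_2,x_3)$ and $q(x_1,o_2,x_3)=f(x_1,o_2,x_3)$. Then $q(\bar x)=f(\bar x)$ for all $\bar x\in\Sigma^3$.
   Context: A binary quasigroup (2-quasigroup) on a nonempty set $\Sigma$ is an operation $q:\Sigma^2\to\Sigma$ such that in $z_0=q(z_1,z_2)$ knowledge of any two of $z_0,z_1,z_2$ uniquely specifies the third. -}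

module Defs where

open import Level using (Level)
open import Data.Product using (Σ; _×_; _,_; ∃; ∃-syntax)
open import Relation.Binary.PropositionalEquality using (_≡_)

∃! : ∀ {a p} {A : Set a} → (A → Set p) → Set _
∃! {A = A} P = Σ A (λ x → P x × (∀ y → P y → x ≡ y))

record IsQuasigroup {a} {S : Set a} (q : S → S → S) : Set a where
  field
    -- given z₁, z₂ there is a unique z₀ (automatic for a function, kept for fidelity)
    solve₀ : ∀ z₁ z₂ → ∃! (λ z₀ → z₀ ≡ q z₁ z₂)
    solve₁ : ∀ z₀ z₂ → ∃! (λ z₁ → z₀ ≡ q z₁ z₂)
    solve₂ : ∀ z₀ z₁ → ∃! (λ z₂ → z₀ ≡ q z₁ z₂)

compose : ∀ {a} {S : Set a} → (S → S → S) → (S → S → S) → S → S → S → S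
compose out inn x₁ x₂ x₃ = out x₁ (inn x₂ x₃)

-- Choose y with qin(o₂, y) = qin(x₂, x₃). The hypothesis at x₂ = o₂ gives
-- q(x̄) = q(x₁, o₂, y) = f(x₁, o₂, y), so it remains to see fin(o₂, y) = fin(x₂, x₃).
-- Evaluating the hypothesis at x₁ = o₁ on both inputs gives
-- fout(o₁, fin(o₂, y)) = qout(o₁, qin(o₂, y)) = qout(o₁, qin(x₂, x₃)) = fout(o₁, fin(x₂, x₃)),
-- and fout(o₁, ·) is injective.
module Submission where

open import Defs
open import Data.Product using (proj₁; proj₂)
open import Relation.Binary.PropositionalEquality
  using (_≡_; refl; sym; trans; cong; module ≡-Reasoning)

module QuasigroupProperties {ℓ} {S : Set ℓ} {_∙_ : S → S → S} (Q : IsQuasigroup _∙_) where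

  open IsQuasigroup Q

  infixl 7 _\\_

  _\\_ : S → S → S
  x \\ z = proj₁ (solve₂ z x)

  leftDividesˡ : ∀ x z → x ∙ (x \\ z) ≡ z
  leftDividesˡ x z = sym (proj₁ (proj₂ (solve₂ z x)))

  cancelˡ : ∀ x y z → x ∙ y ≡ x ∙ z → y ≡ z
  cancelˡ x y z xy≡xz = trans (sym (unique y refl)) (unique z xy≡xz)
    where
    unique : ∀ w → x ∙ y ≡ x ∙ w → x \\ (x ∙ y) ≡ w
    unique = proj₂ (proj₂ (solve₂ (x ∙ y) x))

fin-respects-qin : ∀ {ℓ} {S : Set ℓ} (qin qout : S → S → S) {fin fout : S → S → S} →
  IsQuasigroup fout → ∀ o₁ →
  (∀ x₂ x₃ → compose qout qin o₁ x₂ x₃ ≡ compose fout fin o₁ x₂ x₃) →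
  ∀ {a b c d} → qin a b ≡ qin c d → fin a b ≡ fin c d
fin-respects-qin qin qout {fin} {fout} Fo o₁ agree {a} {b} {c} {d} qab≡qcd =
  QuasigroupProperties.cancelˡ Fo o₁ (fin a b) (fin c d) (begin
    fout o₁ (fin a b)  ≡⟨ sym (agree a b) ⟩
    qout o₁ (qin a b)  ≡⟨ cong (qout o₁) qab≡qcd ⟩
    qout o₁ (qin c d)  ≡⟨ agree c d ⟩
    fout o₁ (fin c d)  ∎)
  where open ≡-Reasoning

corollary1 : (S : Set) → S →
    (qin qout fin fout : S → S → S) →
    IsQuasigroup qin → IsQuasigroup qout → IsQuasigroup fin → IsQuasigroup fout →
    (o₁ o₂ o₃ : S) →
    (∀ x₂ x₃ → compose qout qin o₁ x₂ x₃ ≡ compose fout fin o₁ x₂ x₃) →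
    (∀ x₁ x₃ → compose qout qin x₁ o₂ x₃ ≡ compose fout fin x₁ o₂ x₃) →
    ∀ x₁ x₂ x₃ → compose qout qin x₁ x₂ x₃ ≡ compose fout fin x₁ x₂ x₃
corollary1 S _ qin qout fin fout Qi _ _ Fo o₁ o₂ _ agree₁ agree₂ x₁ x₂ x₃ = begin
  qout x₁ (qin x₂ x₃)  ≡⟨ cong (qout x₁) (sym qin-o₂y) ⟩
  qout x₁ (qin o₂ y)   ≡⟨ agree₂ x₁ y ⟩
  fout x₁ (fin o₂ y)   ≡⟨ cong (fout x₁) (fin-respects-qin qin qout Fo o₁ agree₁ qin-o₂y) ⟩
  fout x₁ (fin x₂ x₃)  ∎
  where
  open ≡-Reasoning
  open QuasigroupProperties Qi using (_\\_; leftDividesˡ)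
  y : S
  y = o₂ \\ qin x₂ x₃
  qin-o₂y : qin o₂ y ≡ qin x₂ x₃
  qin-o₂y = leftDividesˡ o₂ (qin x₂ x₃)
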